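{- Let $(A,B)$ be an instance of 3-Partition and let $\Phi(A,B)=(S,\mathrm{val},\mathcal{E},C)$ be the OCP instance constructed from it as described in the context. In any ordered covering $\mathcal{E}'$ of $\Phi(A,B)$ with $F(\mathcal{E}')\le C$, the $m$ assignment edges appearing in $\mathcal{E}'$ with nonempty residual sets satisfy: the sets $U(E_{ij})\cap S$ (for these edges) are pairwise disjoint, each has exactly three elements, and their union is exactly $S$.
   Context: OCP: an instance consists of a finite label set $S$, a family $\mathcal{E}$ of finite sets with $S\subseteq\bigcup\mathcal{E}$, a weight function $\mathrm{val}$ assigning a positive integer to every element of $\bigcup\mathcal{E}$, and a budget $C\in\mathbb{N}$. An ordered covering is a tuple $\mathcal{E}'=(E'_1,\dots,E'_k)$ of members of $\mathcal{E}$ with $S\subseteq\bigcup_i E'_i$; its residual sets are $U_i=E'_i\setminus\bigcup_{j<i}E'_j$ (written $U(E'_i)$), residual weights $u_i=\sum_{x\in U_i}\mathrm{val}(x)$, partial costs $f(E'_i)=2^{u_i}$ if $u_i>0$ and $0$ if $u_i=0$, and total cost $F(\mathcal{E}')=\sum_i f(E'_i)$. 3-Partition: an instance is a multiset $A=\{a_1,\dots,a_{3m}\}$ of positive integers and a positive integer $B$ with $\sum_{i=1}^{3m}a_i=mB$ and $B/4<a_i<B/2$ for all $i$. The construction $\Phi(A,B)$: let $S=\{\alpha_1,\dots,\alpha_{3m}\}$ with $\mathrm{val}(\alpha_\ell)=a_\ell$ (distinct labels even for repeated values). Let $T$ be the collection of all 3-element subsets $X\subseteq S$ with $\sum_{\alpha\in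 X}\mathrm{val}(\alpha)=B$, enumerated as $X_1,\dots,X_{|T|}$. Set $t=1$ and $w=t+B+\lceil\log_2 m\rceil+1$. For each $i\in\{1,\dots,m\}$ and $j\in\{1,\dots,|T|\}$ introduce two new distinct elements $\omega_{ij},\tau_{ij}\notin S$ (all distinct across pairs $(i,j)$) with $\mathrm{val}(\omega_{ij})=w$ and $\mathrm{val}(\tau_{ij})=t$, and define the opening edge $A_{ij}=\{\omega_{ij}\}$ and the assignment edge $E_{ij}=X_j\cup\{\omega_{ij},\tau_{ij}\}$. Let $\mathcal{E}=\{A_{ij},E_{ij}: i\in\{1,\dots,m\}, j\in\{1,\dots,|T|\}\}$ and $C=m(2^w+2^{t+B})$. -}

module Defs where

open import Data.Nat using (ℕ; zero; suc; _+_; _*_; _^_; _≤_; _<_)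
open import Data.Nat.Logarithm using (⌈log₂_⌉)
open import Data.Bool using (Bool; true; false; _∧_; _∨_; not; if_then_else_)
import Data.Bool as Bool
open import Data.Fin using (Fin; toℕ)
import Data.Fin as Fin
open import Data.Fin.Subset using (Subset; _∈_; _∉_; ∣_∣)
open import Data.List using (List; []; _∷_; _++_; map; length; take; lookup; filterᵇ; allFin; null)
open import Data.Nat.ListAction using (sum)
open import Data.Bool.ListAction using (any)
open import Data.Vec using (tabulate)
import Data.Vec as Vec
open import Data.Vec.Properties using (≡-dec)
open import Data.Product using (_×_; ∃; ∃-syntax; _,_)
open import Relation.Nullary.Decidable using (⌊_⌋)
open import Relation.Binary.PropositionalEquality using (_≡_)

-- Elements of ⋃ 𝓔 for a 3-Partition instance with n = 3m numbers.
-- The index j of X_j ∈ T is represented by the triple X_j itself (a subset of Fin n).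
data Elem (n m : ℕ) : Set where
  α : Fin n → Elem n m
  ω : Fin m → Subset n → Elem n m
  τ : Fin m → Subset n → Elem n m

-- Edges (syntactic); membership in 𝓔 is the predicate InFamily below.
data Edge (n m : ℕ) : Set where
  opening : Fin m → Subset n → Edge n m
  assign  : Fin m → Subset n → Edge n m

isAssign : ∀ {n m} → Edge n m → Bool
isAssign (opening _ _) = false
isAssign (assign _ _)  = true

members : ∀ {n} → Subset n → List (Fin n)
members {n} X = filterᵇ (λ l → Vec.lookup X l) (allFin n)

sameIdx : ∀ {n m} → Fin m → Subset n → Fin m → Subset n → Bool
sameIdx i X i' X' = ⌊ i Fin.≟ i' ⌋ ∧ ⌊ ≡-dec Bool._≟_ X X' ⌋

memb : ∀ {n m} → Elem n m → Edge n m → Bool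
memb (ω i' X') (opening i X) = sameIdx i' X' i X
memb (α _)     (opening _ _) = false
memb (τ _ _)   (opening _ _) = false
memb (α l)     (assign i X)  = Vec.lookup X l
memb (ω i' X') (assign i X)  = sameIdx i' X' i X
memb (τ i' X') (assign i X)  = sameIdx i' X' i X

elems : ∀ {n m} → Edge n m → List (Elem n m)
elems (opening i X) = ω i X ∷ []
elems (assign i X)  = map α (members X) ++ (ω i X ∷ τ i X ∷ [])

module Construction (m : ℕ) (a : Fin (3 * m) → ℕ) (B : ℕ) where

  n : ℕ
  n = 3 * m

  t : ℕ
  t = 1

  w : ℕ
  w = t + B + ⌈log₂ m ⌉ + 1

  val : Elem n m → ℕ
  val (α l)   = a l
  val (ω _ _) = w
  val (τ _ _) = t

  InT : Subset n → Set
  InT X = ∣ X ∣ ≡ 3 × sum (map a (members X)) ≡ B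

  InFamily : Edge n m → Set
  InFamily (opening i X) = InT X
  InFamily (assign i X)  = InT X

  data AllInFamily : List (Edge n m) → Set where
    []  : AllInFamily []
    _∷_ : ∀ {e es} → InFamily e → AllInFamily es → AllInFamily (e ∷ es)

  coveredBy : Elem n m → List (Edge n m) → Bool
  coveredBy x es = any (memb x) es

  Covers : List (Edge n m) → Set
  Covers es = ∀ (l : Fin n) → ∃[ k ] memb (α l) (lookup es k) ≡ true

  U : (es : List (Edge n m)) → Fin (length es) → List (Elem n m)
  U es k = filterᵇ (λ x → not (coveredBy x (take (toℕ k) es))) (elems (lookup es k))

  u : (es : List (Edge n m)) → Fin (length es) → ℕ
  u es k = sum (map val (U es k))

  f : ℕ → ℕ
  f zero    = 0
  f (suc x) = 2 ^ suc x

  F : List (Edge n m) → ℕ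
  F es = sum (map (λ k → f (u es k)) (allFin (length es)))

  C : ℕ
  C = m * (2 ^ w + 2 ^ (t + B))

  US : (es : List (Edge n m)) → Fin (length es) → Subset n
  US es k = tabulate (λ l → memb (α l) (lookup es k) ∧ not (coveredBy (α l) (take (toℕ k) es)))

  goodᵇ : (es : List (Edge n m)) → Fin (length es) → Bool
  goodᵇ es k = isAssign (lookup es k) ∧ not (null (U es k))

  Good : (es : List (Edge n m)) → Fin (length es) → Set
  Good es k = goodᵇ es k ≡ true

-- An assignment edge E_ij with nonempty residual has τ_ij still uncovered, since τ_ij lies in no
-- other edge; and τ_ij can only become covered together with, or after, ω_ij, which then costs at
-- least 2^w. Charging each such edge to the step covering its ω_ij, a covering with k of them costs
-- at least k·2^w, and C < (m+1)·2^w because m·2^(t+B) < 2^w; so k ≤ m. Conversely the residual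
-- S-parts partition S, so their weights sum to mB, while each weighs at most B (it lies in a triple
-- X_j) and is empty unless its edge is counted by k; so k ≥ m. Hence k = m and every residual S-part
-- has weight exactly B, which for positive weights forces it to be the whole triple X_j.

module Submission where

open import Defs
open import Data.Nat
open import Data.Nat.Properties
open import Data.Nat.Logarithm using (⌈log₂_⌉; ⌈log₂⌉-mono-≤; ⌈log₂2^n⌉≡n)
open import Data.Nat.ListAction using (sum)
open import Data.Nat.Tactic.RingSolver using (solve-∀)
open import Data.Bool using (Bool; true; false; T; _∧_; _∨_; not)
import Data.Bool as Bool
open import Data.Bool.Properties using (T-≡; ∨-identityʳ; ∨-assoc)
open import Data.Bool.ListAction using (any)
open import Data.Fin using (Fin; toℕ; zero; suc)
import Data.Fin as Fin
import Data.Fin.Properties as Fin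
open import Data.Fin.Subset using (Subset; ∣_∣)
import Data.Fin.Subset as Subset
open import Data.List using (List; []; _∷_; _++_; map; length; take; lookup; filterᵇ; allFin; null; tabulate)
open import Data.List.Properties
  using (map-tabulate; tabulate-cong; ++-identityʳ; ++-assoc; length-filter; filter-notAll)
open import Data.List.Membership.Propositional using (_∈_; find; lose)
open import Data.List.Membership.Propositional.Properties
  using (∈-map⁺; ∈-map⁻; ∈-++⁺ˡ; ∈-++⁺ʳ; ∈-++⁻; ∈-allFin; ∈-lookup; ∈-filter⁺; ∈-filter⁻)
open import Data.List.Relation.Unary.Any using (here; there)
open import Data.List.Relation.Unary.Any.Properties using (any⁺; any⁻)
open import Data.Product using (_×_; ∃-syntax; _,_; proj₁; proj₂)
open import Data.Sum using (inj₁; inj₂)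
open import Data.Empty using (⊥-elim)
open import Data.Vec.Properties using (≡-dec; lookup∘tabulate; tabulate∘lookup; []=⇒lookup; lookup⇒[]=)
import Data.Vec as Vec
import Data.Vec.Properties as Vec
open import Function using (_∘_; id; Equivalence)
open import Relation.Binary using (tri<; tri≈; tri>)
open import Relation.Binary.PropositionalEquality
open import Relation.Nullary using (yes; no)
open import Relation.Nullary.Decidable using (T?)

bit : Bool → ℕ
bit true  = 1
bit false = 0

bit≤1 : ∀ b → bit b ≤ 1
bit≤1 true  = s≤s z≤n
bit≤1 false = z≤n

bit[x∧y]*z≤bit[x]*z : ∀ x y z → bit (x ∧ y) * z ≤ bit x * z
bit[x∧y]*z≤bit[x]*z false y z = ≤-refl
bit[x∧y]*z≤bit[x]*z true  y z = *-monoˡ-≤ z (bit≤1 y)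

bit[x∧y]*z≡bit[x]*z⇒x∧y≡x : ∀ x y {z} → 0 < z → bit (x ∧ y) * z ≡ bit x * z → x ∧ y ≡ x
bit[x∧y]*z≡bit[x]*z⇒x∧y≡x false y     _   _ = refl
bit[x∧y]*z≡bit[x]*z⇒x∧y≡x true  true  _   _ = refl
bit[x∧y]*z≡bit[x]*z⇒x∧y≡x true  false {z} z>0 eq = ⊥-elim (<-irrefl (trans eq (+-identityʳ z)) z>0)

true≢false : true ≢ false
true≢false ()

∨≡false⁻ : ∀ {b c} → b ∨ c ≡ false → b ≡ false × c ≡ false
∨≡false⁻ {false} {false} refl = refl , refl

∨≡true-elimʳ : ∀ {b c} → b ∨ c ≡ true → c ≡ false → b ≡ true
∨≡true-elimʳ {true}  _ _ = refl
∨≡true-elimʳ {false} refl ()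

module _ {A : Set} (p : A → Bool) where

  any≡true⁻ : ∀ xs → any p xs ≡ true → ∃[ x ] (x ∈ xs × p x ≡ true)
  any≡true⁻ xs h with find (any⁻ p xs (Equivalence.from T-≡ h))
  ... | x , x∈ , px = x , x∈ , Equivalence.to T-≡ px

  any≡true⁺ : ∀ {x xs} → x ∈ xs → p x ≡ true → any p xs ≡ true
  any≡true⁺ x∈ px = Equivalence.to T-≡ (any⁺ p (lose x∈ (Equivalence.from T-≡ px)))

  any-∷ʳ : ∀ xs y → any p (xs ++ y ∷ []) ≡ any p xs ∨ p y
  any-∷ʳ []       y = ∨-identityʳ (p y)
  any-∷ʳ (x ∷ xs) y rewrite any-∷ʳ xs y = sym (∨-assoc (p x) (any p xs) (p y))

  ∈-filterᵇ⁺ : ∀ {x xs} → x ∈ xs → p x ≡ true → x ∈ filterᵇ p xs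
  ∈-filterᵇ⁺ x∈ px = ∈-filter⁺ (T? ∘ p) x∈ (Equivalence.from T-≡ px)

  ∈-filterᵇ⁻ : ∀ {x} xs → x ∈ filterᵇ p xs → x ∈ xs × p x ≡ true
  ∈-filterᵇ⁻ xs x∈ with ∈-filter⁻ (T? ∘ p) {xs = xs} x∈
  ... | x∈xs , px = x∈xs , Equivalence.to T-≡ px

  length-filterᵇ<length : ∀ {x xs} → x ∈ xs → p x ≡ false → length (filterᵇ p xs) < length xs
  length-filterᵇ<length {xs = xs} x∈ px = filter-notAll (T? ∘ p) xs (lose x∈ (subst T px))

  filterᵇ-none : ∀ xs → (∀ x → x ∈ xs → p x ≡ false) → filterᵇ p xs ≡ []
  filterᵇ-none []       h = refl
  filterᵇ-none (x ∷ xs) h rewrite h x (here refl) = filterᵇ-none xs (λ y y∈ → h y (there y∈))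

  length-filterᵇ : ∀ xs → length (filterᵇ p xs) ≡ sum (map (bit ∘ p) xs)
  length-filterᵇ []       = refl
  length-filterᵇ (x ∷ xs) with p x
  ... | true  = cong suc (length-filterᵇ xs)
  ... | false = length-filterᵇ xs

  sum-map-filterᵇ : (g : A → ℕ) → ∀ xs →
    sum (map g (filterᵇ p xs)) ≡ sum (map (λ x → bit (p x) * g x) xs)
  sum-map-filterᵇ g []       = refl
  sum-map-filterᵇ g (x ∷ xs) with p x
  ... | true  = cong₂ _+_ (sym (+-identityʳ (g x))) (sum-map-filterᵇ g xs)
  ... | false = sum-map-filterᵇ g xs

  first-index : ∀ xs (k : Fin (length xs)) → p (lookup xs k) ≡ true →
    ∃[ k′ ] (p (lookup xs k′) ≡ true × any p (take (toℕ k′) xs) ≡ false)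
  first-index (x ∷ xs) k h with p x in eq
  first-index (x ∷ xs) k       h | true  = zero , eq , refl
  first-index (x ∷ xs) zero    h | false = ⊥-elim (true≢false (trans (sym h) eq))
  first-index (x ∷ xs) (suc k) h | false with first-index xs k h
  ... | k′ , pk′ , before = suc k′ , pk′ , trans (cong (_∨ any p (take (toℕ k′) xs)) eq) before

∈⇒null≡false : ∀ {A : Set} {x : A} {xs} → x ∈ xs → null xs ≡ false
∈⇒null≡false (here _)  = refl
∈⇒null≡false (there _) = refl

lookup∈take : ∀ {A : Set} (xs : List A) (k k′ : Fin (length xs)) →
  toℕ k < toℕ k′ → lookup xs k ∈ take (toℕ k′) xs
lookup∈take (x ∷ xs) zero    (suc k′) _         = here refl
lookup∈take (x ∷ xs) (suc k) (suc k′) (s≤s k<k′) = there (lookup∈take xs k k′ k<k′)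

module _ {A : Set} where

  sum-map-cong : (f g : A → ℕ) → ∀ xs → (∀ x → x ∈ xs → f x ≡ g x) →
    sum (map f xs) ≡ sum (map g xs)
  sum-map-cong f g []       h = refl
  sum-map-cong f g (x ∷ xs) h = cong₂ _+_ (h x (here refl)) (sum-map-cong f g xs (λ y y∈ → h y (there y∈)))

  sum-map-mono-≤ : (f g : A → ℕ) → ∀ xs → (∀ x → x ∈ xs → f x ≤ g x) →
    sum (map f xs) ≤ sum (map g xs)
  sum-map-mono-≤ f g []       h = z≤n
  sum-map-mono-≤ f g (x ∷ xs) h =
    +-mono-≤ (h x (here refl)) (sum-map-mono-≤ f g xs (λ y y∈ → h y (there y∈)))

  sum-map-mono-≤-equality : (f g : A → ℕ) → ∀ xs → (∀ x → x ∈ xs → f x ≤ g x) →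
    sum (map g xs) ≤ sum (map f xs) → ∀ x → x ∈ xs → f x ≡ g x
  sum-map-mono-≤-equality f g (y ∷ ys) h sg≤sf x (here refl) =
    ≤-antisym (h y (here refl))
      (+-cancelʳ-≤ (sum (map g ys)) (g y) (f y)
        (≤-trans sg≤sf (+-monoʳ-≤ (f y) (sum-map-mono-≤ f g ys (λ z z∈ → h z (there z∈))))))
  sum-map-mono-≤-equality f g (y ∷ ys) h sg≤sf x (there x∈) =
    sum-map-mono-≤-equality f g ys (λ z z∈ → h z (there z∈))
      (+-cancelˡ-≤ (g y) _ _ (≤-trans sg≤sf (+-monoˡ-≤ (sum (map f ys)) (h y (here refl))))) x x∈

  ∈⇒≤sum-map : (g : A → ℕ) → ∀ {x xs} → x ∈ xs → g x ≤ sum (map g xs)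
  ∈⇒≤sum-map g {xs = y ∷ ys} (here refl) = m≤m+n (g y) _
  ∈⇒≤sum-map g {xs = y ∷ ys} (there x∈)  = ≤-trans (∈⇒≤sum-map g x∈) (m≤n+m _ (g y))

  sum-map-zero : ∀ (xs : List A) → sum (map (λ _ → 0) xs) ≡ 0
  sum-map-zero []       = refl
  sum-map-zero (x ∷ xs) = sum-map-zero xs

  sum-map-+ : (f g : A → ℕ) → ∀ xs → sum (map (λ x → f x + g x) xs) ≡ sum (map f xs) + sum (map g xs)
  sum-map-+ f g []       = refl
  sum-map-+ f g (x ∷ xs) rewrite sum-map-+ f g xs = interchange (f x) (g x) (sum (map f xs)) (sum (map g xs))
    where
    interchange : ∀ a b c d → a + b + (c + d) ≡ a + c + (b + d)
    interchange = solve-∀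

  sum-map-*ˡ : (c : ℕ) (f : A → ℕ) → ∀ xs → sum (map (λ x → c * f x) xs) ≡ c * sum (map f xs)
  sum-map-*ˡ c f []       = sym (*-zeroʳ c)
  sum-map-*ˡ c f (x ∷ xs) rewrite sum-map-*ˡ c f xs = sym (*-distribˡ-+ c (f x) _)

module _ {A : Set} where

  historySum : (List A → A → ℕ) → List A → List A → ℕ
  historySum h pre []       = 0
  historySum h pre (e ∷ es) = h pre e + historySum h (pre ++ e ∷ []) es

  sum-allFin≡historySum : (h : List A → A → ℕ) (pre es : List A) →
    sum (map (λ k → h (pre ++ take (toℕ k) es) (lookup es k)) (allFin (length es))) ≡ historySum h pre es
  sum-allFin≡historySum h pre []       = refl
  sum-allFin≡historySum h pre (e ∷ es) = cong₂ _+_ (cong (λ z → h z e) (++-identityʳ pre)) (begin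
    sum (map atPosition (tabulate Fin.suc))   ≡⟨ cong sum (map-tabulate Fin.suc atPosition) ⟩
    sum (tabulate (atPosition ∘ Fin.suc))     ≡⟨ cong sum (tabulate-cong reassociate) ⟩
    sum (tabulate atLaterPosition)            ≡⟨ cong sum (map-tabulate id atLaterPosition) ⟨
    sum (map atLaterPosition (allFin (length es))) ≡⟨ sum-allFin≡historySum h (pre ++ e ∷ []) es ⟩
    historySum h (pre ++ e ∷ []) es           ∎)
    where
    open ≡-Reasoning
    atPosition : Fin (length (e ∷ es)) → ℕ
    atPosition k = h (pre ++ take (toℕ k) (e ∷ es)) (lookup (e ∷ es) k)
    atLaterPosition : Fin (length es) → ℕ
    atLaterPosition k = h ((pre ++ e ∷ []) ++ take (toℕ k) es) (lookup es k)
    reassociate : ∀ k → atPosition (Fin.suc k) ≡ atLaterPosition k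
    reassociate k = cong (λ z → h z (lookup es k)) (sym (++-assoc pre (e ∷ []) (take (toℕ k) es)))

  historySum-mono-≤ : (h₁ h₂ : List A → A → ℕ) → (∀ pre e → h₁ pre e ≤ h₂ pre e) →
    ∀ pre es → historySum h₁ pre es ≤ historySum h₂ pre es
  historySum-mono-≤ h₁ h₂ h pre []       = z≤n
  historySum-mono-≤ h₁ h₂ h pre (e ∷ es) =
    +-mono-≤ (h pre e) (historySum-mono-≤ h₁ h₂ h (pre ++ e ∷ []) es)

  historySum-*ˡ : (c : ℕ) (h : List A → A → ℕ) →
    ∀ pre es → historySum (λ p e → c * h p e) pre es ≡ c * historySum h pre es
  historySum-*ˡ c h pre []       = sym (*-zeroʳ c)
  historySum-*ˡ c h pre (e ∷ es) rewrite historySum-*ˡ c h (pre ++ e ∷ []) es = sym (*-distribˡ-+ c (h pre e) _)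

telescope-≤ : ∀ {x y d d′ s r} → x ≤ y + d′ → s + d′ ≤ r + d → s + x ≤ r + y + d
telescope-≤ {x} {y} {d} {d′} {s} {r} x≤ step = begin
  s + x          ≤⟨ +-monoʳ-≤ s x≤ ⟩
  s + (y + d′)   ≡⟨ swap s y d′ ⟩
  y + (s + d′)   ≤⟨ +-monoʳ-≤ y step ⟩
  y + (r + d)    ≡⟨ swap y r d ⟩
  r + (y + d)    ≡⟨ +-assoc r y d ⟨
  r + y + d      ∎
  where
  open ≤-Reasoning
  swap : ∀ a b c → a + (b + c) ≡ b + (a + c)
  swap = solve-∀

module _ {n m : ℕ} where

  sameIdx-refl : (i : Fin m) (X : Subset n) → sameIdx i X i X ≡ true
  sameIdx-refl i X with i Fin.≟ i | ≡-dec Bool._≟_ X X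
  ... | yes _ | yes _ = refl
  ... | no i≢i | _     = ⊥-elim (i≢i refl)
  ... | yes _ | no X≢X = ⊥-elim (X≢X refl)

  sameIdx⇒≡ : (i i′ : Fin m) (X X′ : Subset n) → sameIdx i X i′ X′ ≡ true → i ≡ i′ × X ≡ X′
  sameIdx⇒≡ i i′ X X′ h with i Fin.≟ i′ | ≡-dec Bool._≟_ X X′
  sameIdx⇒≡ i i′ X X′ h  | yes i≡i′ | yes X≡X′ = i≡i′ , X≡X′
  sameIdx⇒≡ i i′ X X′ () | yes _    | no _
  sameIdx⇒≡ i i′ X X′ () | no _     | _

  memb-α⇒∈elems : ∀ l (e : Edge n m) → memb (α l) e ≡ true → α l ∈ elems e
  memb-α⇒∈elems l (assign i X) h = ∈-++⁺ˡ (∈-map⁺ α (∈-filterᵇ⁺ (Vec.lookup X) (∈-allFin l) h))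

  ∈elems⇒memb : ∀ x (e : Edge n m) → x ∈ elems e → memb x e ≡ true
  ∈elems⇒memb x (opening i X) (here refl) = sameIdx-refl i X
  ∈elems⇒memb x (assign i X) x∈ with ∈-++⁻ (map α (members X)) x∈
  ... | inj₂ (here refl)         = sameIdx-refl i X
  ... | inj₂ (there (here refl)) = sameIdx-refl i X
  ... | inj₁ x∈α with ∈-map⁻ α x∈α
  ... | l , l∈ , refl = proj₂ (∈-filterᵇ⁻ (Vec.lookup X) (allFin n) l∈)

  ωOf : Edge n m → Elem n m
  ωOf (opening i X) = ω i X
  ωOf (assign i X)  = ω i X

  ωOf∈elems : ∀ e → ωOf e ∈ elems e
  ωOf∈elems (opening i X) = here refl
  ωOf∈elems (assign i X)  = ∈-++⁺ʳ (map α (members X)) (here refl)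

  residual : List (Edge n m) → Edge n m → List (Elem n m)
  residual pre e = filterᵇ (λ x → not (any (memb x) pre)) (elems e)

  goodAfter : List (Edge n m) → Edge n m → Bool
  goodAfter pre e = isAssign e ∧ not (null (residual pre e))

  freshα⇒goodAfter : ∀ l pre e →
    memb (α l) e ∧ not (any (memb (α l)) pre) ≡ true → goodAfter pre e ≡ true
  freshα⇒goodAfter l pre (assign i X) h with Vec.lookup X l in l∈X | any (memb (α l)) pre in covered
  ... | true | false
    rewrite ∈⇒null≡false (∈-filterᵇ⁺ (λ x → not (any (memb x) pre))
              (memb-α⇒∈elems l (assign i X) l∈X) (cong not covered)) = refl

  freshτ : List (Edge n m) → Edge n m → ℕ
  freshτ pre (opening i X) = 0
  freshτ pre (assign i X)  = bit (not (any (memb (τ i X)) pre))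

  freshω : List (Edge n m) → Edge n m → ℕ
  freshω pre e = bit (not (any (memb (ωOf e)) pre))

  -- τ i X lies in no edge but assign i X, so once it is covered the whole edge is.
  goodAfter≤freshτ : ∀ pre e → bit (goodAfter pre e) ≤ freshτ pre e
  goodAfter≤freshτ pre (opening i X) = z≤n
  goodAfter≤freshτ pre (assign i X) with any (memb (τ i X)) pre in τ-covered
  ... | false = bit≤1 _
  ... | true with any≡true⁻ (memb (τ i X)) pre τ-covered
  ... | assign i′ X′ , e∈ , h with sameIdx⇒≡ i i′ X X′ h
  ... | refl , refl
    rewrite filterᵇ-none (λ x → not (any (memb x) pre)) (elems (assign i X))
              (λ x x∈ → cong not (any≡true⁺ (memb x) e∈ (∈elems⇒memb x (assign i X) x∈))) = z≤n

  Pending : List (Edge n m) → List (Fin m × Subset n) → Set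
  Pending pre D = ∀ i X → any (memb (ω i X)) pre ≡ true → any (memb (τ i X)) pre ≡ false → (i , X) ∈ D

  pending-opening : ∀ pre i X D D′ → Pending pre D → (∀ {k} → k ∈ D → k ∈ D′) →
    (any (memb (ω i X)) pre ≡ false → (i , X) ∈ D′) → Pending (pre ++ opening i X ∷ []) D′
  pending-opening pre i X D D′ pending D⊆D′ fresh⇒∈D′ i′ X′ hω hτ
    rewrite any-∷ʳ (memb (ω i′ X′)) pre (opening i X) | any-∷ʳ (memb (τ i′ X′)) pre (opening i X)
    with sameIdx i′ X′ i X in same
  ... | false = D⊆D′ (pending i′ X′ (∨≡true-elimʳ hω refl) (proj₁ (∨≡false⁻ hτ)))
  ... | true with sameIdx⇒≡ i′ i X′ X same
  ... | refl , refl with any (memb (ω i X)) pre in ω-covered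
  ... | true  = D⊆D′ (pending i X ω-covered (proj₁ (∨≡false⁻ hτ)))
  ... | false = fresh⇒∈D′ refl

  pending-step : ∀ pre e D → Pending pre D →
    ∃[ D′ ] (Pending (pre ++ e ∷ []) D′ × freshτ pre e + length D′ ≤ freshω pre e + length D)
  pending-step pre (opening i X) D pending with any (memb (ω i X)) pre in ω-covered
  ... | true  = D , pending-opening pre i X D D pending id
                       (λ fresh → ⊥-elim (true≢false (trans (sym ω-covered) fresh))) , ≤-refl
  ... | false = (i , X) ∷ D , pending-opening pre i X D ((i , X) ∷ D) pending there (λ _ → here refl) , ≤-refl
  pending-step pre (assign i X) D pending = D′ , pending′ , step
    where
    other : Fin m × Subset n → Bool
    other (i′ , X′) = not (sameIdx i′ X′ i X)
    D′ : List (Fin m × Subset n)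
    D′ = filterᵇ other D
    pending′ : Pending (pre ++ assign i X ∷ []) D′
    pending′ i′ X′ hω hτ
      rewrite any-∷ʳ (memb (ω i′ X′)) pre (assign i X) | any-∷ʳ (memb (τ i′ X′)) pre (assign i X)
      with ∨≡false⁻ hτ
    ... | hτ′ , not-same =
      ∈-filterᵇ⁺ other (pending i′ X′ (∨≡true-elimʳ hω not-same) hτ′) (cong not not-same)
    step : freshτ pre (assign i X) + length D′ ≤ freshω pre (assign i X) + length D
    step with any (memb (τ i X)) pre in τ-covered | any (memb (ω i X)) pre in ω-covered
    ... | true  | _     = ≤-trans (length-filter (T? ∘ other) D) (m≤n+m _ _)
    ... | false | false = s≤s (length-filter (T? ∘ other) D)
    ... | false | true  =
      length-filterᵇ<length other (pending i X ω-covered τ-covered) (cong not (sameIdx-refl i X))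

  -- Every τ i X becoming covered is charged to the step that covered ω i X: the same
  -- step, or an earlier opening edge whose key is then pending in D.
  historySum-freshτ≤freshω : ∀ es pre D → Pending pre D →
    historySum freshτ pre es ≤ historySum freshω pre es + length D
  historySum-freshτ≤freshω []       pre D pending = z≤n
  historySum-freshτ≤freshω (e ∷ es) pre D pending with pending-step pre e D pending
  ... | D′ , pending′ , step =
    telescope-≤ {s = freshτ pre e} {r = freshω pre e} (historySum-freshτ≤freshω es (pre ++ e ∷ []) D′ pending′) step

m<2^[⌈log₂m⌉+1] : ∀ m → m < 2 ^ (⌈log₂ m ⌉ + 1)
m<2^[⌈log₂m⌉+1] m with 2 ^ (⌈log₂ m ⌉ + 1) ≤? m
... | no  2^≰m = ≰⇒> 2^≰m
... | yes 2^≤m =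
  ⊥-elim (m+1+n≰m ⌈log₂ m ⌉ (subst (_≤ ⌈log₂ m ⌉) (⌈log₂2^n⌉≡n (⌈log₂ m ⌉ + 1)) (⌈log₂⌉-mono-≤ 2^≤m)))

module Bounds (m : ℕ) (a : Fin (3 * m) → ℕ) (B : ℕ) where
  open Construction m a B

  goodCount : List (Edge n m) → ℕ
  goodCount es = length (filterᵇ (goodᵇ es) (allFin (length es)))

  2^w≤f : ∀ {x} → w ≤ x → 2 ^ w ≤ f x
  2^w≤f {suc x} w≤x = ^-monoʳ-≤ 2 w≤x

  val-ωOf : ∀ e → val (ωOf e) ≡ w
  val-ωOf (opening i X) = refl
  val-ωOf (assign i X)  = refl

  2^w*freshω≤f : ∀ pre e → 2 ^ w * freshω pre e ≤ f (sum (map val (residual pre e)))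
  2^w*freshω≤f pre e with any (memb (ωOf e)) pre in ω-covered
  ... | true  rewrite *-zeroʳ (2 ^ w) = z≤n
  ... | false rewrite *-identityʳ (2 ^ w) =
    2^w≤f (subst (_≤ sum (map val (residual pre e))) (val-ωOf e)
      (∈⇒≤sum-map val (∈-filterᵇ⁺ (λ x → not (any (memb x) pre)) (ωOf∈elems e) (cong not ω-covered))))

  2^w*goodCount≤F : ∀ es → 2 ^ w * goodCount es ≤ F es
  2^w*goodCount≤F es = begin
    2 ^ w * goodCount es
      ≡⟨ cong (2 ^ w *_) (trans (length-filterᵇ (goodᵇ es) (allFin (length es))) (sum-allFin≡historySum good [] es)) ⟩
    2 ^ w * historySum good [] es
      ≤⟨ *-monoʳ-≤ (2 ^ w) (historySum-mono-≤ good freshτ goodAfter≤freshτ [] es) ⟩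
    2 ^ w * historySum freshτ [] es
      ≤⟨ *-monoʳ-≤ (2 ^ w) (≤-trans (historySum-freshτ≤freshω es [] [] (λ _ _ ())) (≤-reflexive (+-identityʳ _))) ⟩
    2 ^ w * historySum freshω [] es
      ≡⟨ historySum-*ˡ (2 ^ w) freshω [] es ⟨
    historySum (λ pre e → 2 ^ w * freshω pre e) [] es
      ≤⟨ historySum-mono-≤ _ cost 2^w*freshω≤f [] es ⟩
    historySum cost [] es
      ≡⟨ sum-allFin≡historySum cost [] es ⟨
    F es ∎
    where
    open ≤-Reasoning
    good : List (Edge n m) → Edge n m → ℕ
    good pre e = bit (goodAfter pre e)
    cost : List (Edge n m) → Edge n m → ℕ
    cost pre e = f (sum (map val (residual pre e)))

  m*2^[t+B]<2^w : m * 2 ^ (t + B) < 2 ^ w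
  m*2^[t+B]<2^w = begin-strict
    m * 2 ^ (1 + B)                       <⟨ *-monoˡ-< (2 ^ (1 + B)) {{m^n≢0 2 (1 + B)}} (m<2^[⌈log₂m⌉+1] m) ⟩
    2 ^ (⌈log₂ m ⌉ + 1) * 2 ^ (1 + B)     ≡⟨ ^-distribˡ-+-* 2 (⌈log₂ m ⌉ + 1) (1 + B) ⟨
    2 ^ ((⌈log₂ m ⌉ + 1) + (1 + B))       ≡⟨ cong (2 ^_) (exponent ⌈log₂ m ⌉ B) ⟩
    2 ^ w                                 ∎
    where
    open ≤-Reasoning
    exponent : ∀ L B → (L + 1) + (1 + B) ≡ 1 + B + L + 1
    exponent = solve-∀

  goodCount≤m : ∀ es → F es ≤ C → goodCount es ≤ m
  goodCount≤m es F≤C = ≤-pred (*-cancelʳ-< _ _ _ (begin-strict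
    goodCount es * 2 ^ w            ≡⟨ *-comm (goodCount es) _ ⟩
    2 ^ w * goodCount es            ≤⟨ ≤-trans (2^w*goodCount≤F es) F≤C ⟩
    m * (2 ^ w + 2 ^ (t + B))       ≡⟨ *-distribˡ-+ m _ _ ⟩
    m * 2 ^ w + m * 2 ^ (t + B)     <⟨ +-monoʳ-< (m * 2 ^ w) m*2^[t+B]<2^w ⟩
    m * 2 ^ w + 2 ^ w               ≡⟨ +-comm (m * 2 ^ w) _ ⟩
    suc m * 2 ^ w                   ∎))
    where open ≤-Reasoning

  freshWeight : List (Edge n m) → Edge n m → ℕ
  freshWeight pre e = sum (map (λ l → bit (memb (α l) e ∧ not (any (memb (α l)) pre)) * a l) (allFin n))

  coveredWeight : List (Edge n m) → ℕ
  coveredWeight pre = sum (map (λ l → bit (any (memb (α l)) pre) * a l) (allFin n))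

  freshWeight+coveredWeight : ∀ pre e →
    freshWeight pre e + coveredWeight pre ≡ coveredWeight (pre ++ e ∷ [])
  freshWeight+coveredWeight pre e = trans (sym (sum-map-+ _ _ (allFin n))) (sum-map-cong _ _ (allFin n) λ l _ →
    trans (bit-split (memb (α l) e) (any (memb (α l)) pre) (a l))
          (cong (λ b → bit b * a l) (sym (any-∷ʳ (memb (α l)) pre e))))
    where
    bit-split : ∀ x c z → bit (x ∧ not c) * z + bit c * z ≡ bit (c ∨ x) * z
    bit-split true  true  z = refl
    bit-split true  false z = +-identityʳ _
    bit-split false true  z = refl
    bit-split false false z = refl

  historySum-freshWeight : ∀ es pre →
    historySum freshWeight pre es + coveredWeight pre ≡ coveredWeight (pre ++ es)
  historySum-freshWeight []       pre = cong coveredWeight (sym (++-identityʳ pre))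
  historySum-freshWeight (e ∷ es) pre = begin
    freshWeight pre e + historySum freshWeight pre′ es + coveredWeight pre
      ≡⟨ swap (freshWeight pre e) _ (coveredWeight pre) ⟩
    historySum freshWeight pre′ es + (freshWeight pre e + coveredWeight pre)
      ≡⟨ cong (historySum freshWeight pre′ es +_) (freshWeight+coveredWeight pre e) ⟩
    historySum freshWeight pre′ es + coveredWeight pre′
      ≡⟨ historySum-freshWeight es pre′ ⟩
    coveredWeight (pre′ ++ es)
      ≡⟨ cong coveredWeight (++-assoc pre (e ∷ []) es) ⟩
    coveredWeight (pre ++ e ∷ es) ∎
    where
    open ≡-Reasoning
    pre′ : List (Edge n m)
    pre′ = pre ++ e ∷ []
    swap : ∀ x y z → x + y + z ≡ y + (x + z)
    swap = solve-∀

  Covers⇒sum≡historySum-freshWeight : ∀ es → Covers es →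
    sum (map a (allFin n)) ≡ historySum freshWeight [] es
  Covers⇒sum≡historySum-freshWeight es covers = begin
    sum (map a (allFin n))
      ≡⟨ sum-map-cong _ _ (allFin n) (λ l _ → covered l) ⟩
    coveredWeight es
      ≡⟨ historySum-freshWeight es [] ⟨
    historySum freshWeight [] es + coveredWeight []
      ≡⟨ cong (historySum freshWeight [] es +_) (sum-map-zero (allFin n)) ⟩
    historySum freshWeight [] es + 0
      ≡⟨ +-identityʳ _ ⟩
    historySum freshWeight [] es ∎
    where
    open ≡-Reasoning
    covered : ∀ l → a l ≡ bit (any (memb (α l)) es) * a l
    covered l with covers l
    ... | k , l∈k =
      sym (trans (cong (λ b → bit b * a l) (any≡true⁺ (memb (α l)) (∈-lookup {xs = es} k) l∈k)) (+-identityʳ (a l)))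

  lookup-AllInFamily : ∀ {es} → AllInFamily es → ∀ k → InFamily (lookup es k)
  lookup-AllInFamily (e∈ ∷ _)   zero    = e∈
  lookup-AllInFamily (_ ∷ es∈) (suc k) = lookup-AllInFamily es∈ k

  InT⇒weight≡B : ∀ X → InT X → sum (map (λ l → bit (Vec.lookup X l) * a l) (allFin n)) ≡ B
  InT⇒weight≡B X (_ , weight≡B) = trans (sym (sum-map-filterᵇ (Vec.lookup X) a (allFin n))) weight≡B

  freshWeight≤B*goodAfter : ∀ pre e → InFamily e → freshWeight pre e ≤ B * bit (goodAfter pre e)
  freshWeight≤B*goodAfter pre (opening i X) _ = ≤-trans (≤-reflexive (sum-map-zero (allFin n))) z≤n
  freshWeight≤B*goodAfter pre (assign i X) X∈T with goodAfter pre (assign i X) in good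
  ... | true  = begin
    freshWeight pre (assign i X)
      ≤⟨ sum-map-mono-≤ _ _ (allFin n) (λ l _ → bit[x∧y]*z≤bit[x]*z (Vec.lookup X l) _ (a l)) ⟩
    sum (map (λ l → bit (Vec.lookup X l) * a l) (allFin n))
      ≡⟨ InT⇒weight≡B X X∈T ⟩
    B
      ≡⟨ *-identityʳ B ⟨
    B * 1 ∎
    where open ≤-Reasoning
  ... | false = ≤-trans (≤-reflexive (trans (sum-map-cong _ _ (allFin n) stale) (sum-map-zero (allFin n)))) z≤n
    where
    stale : ∀ l → l ∈ allFin n → bit (Vec.lookup X l ∧ not (any (memb (α l)) pre)) * a l ≡ 0
    stale l _ with Vec.lookup X l ∧ not (any (memb (α l)) pre) in fresh
    ... | false = refl
    ... | true  = ⊥-elim (true≢false (trans (sym (freshα⇒goodAfter l pre (assign i X) fresh)) good))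

  freshWeight≡B⇒∣fresh∣≡3 : ∀ pre e → (∀ l → 0 < a l) → InFamily e →
    goodAfter pre e ≡ true → freshWeight pre e ≡ B →
    ∣ Vec.tabulate (λ l → memb (α l) e ∧ not (any (memb (α l)) pre)) ∣ ≡ 3
  freshWeight≡B⇒∣fresh∣≡3 pre (assign i X) a>0 X∈T _ weight≡B =
    trans (cong ∣_∣ (trans (Vec.tabulate-cong all-fresh) (tabulate∘lookup X))) (proj₁ X∈T)
    where
    pointwise : ∀ l → l ∈ allFin n →
      bit (Vec.lookup X l ∧ not (any (memb (α l)) pre)) * a l ≡ bit (Vec.lookup X l) * a l
    pointwise = sum-map-mono-≤-equality _ _ (allFin n) (λ l _ → bit[x∧y]*z≤bit[x]*z (Vec.lookup X l) _ (a l))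
      (≤-reflexive (trans (InT⇒weight≡B X X∈T) (sym weight≡B)))
    all-fresh : ∀ l → Vec.lookup X l ∧ not (any (memb (α l)) pre) ≡ Vec.lookup X l
    all-fresh l = bit[x∧y]*z≡bit[x]*z⇒x∧y≡x (Vec.lookup X l) _ (a>0 l) (pointwise l (∈-allFin l))

  ∈US⁻ : ∀ es k l → l Subset.∈ US es k →
    memb (α l) (lookup es k) ≡ true × any (memb (α l)) (take (toℕ k) es) ≡ false
  ∈US⁻ es k l l∈
    with memb (α l) (lookup es k) | any (memb (α l)) (take (toℕ k) es) | trans (sym (lookup∘tabulate _ l)) ([]=⇒lookup l∈)
  ... | true  | false | _  = refl , refl
  ... | true  | true  | ()
  ... | false | _     | ()

  US-disjoint : ∀ es k k′ → k ≢ k′ → ∀ l → l Subset.∈ US es k → l Subset.∉ US es k′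
  US-disjoint es k k′ k≢k′ l l∈k l∈k′ with ∈US⁻ es k l l∈k | ∈US⁻ es k′ l l∈k′ | Fin.<-cmp k k′
  ... | in-k , _ | _ , before-k′ | tri< k<k′ _ _ =
    true≢false (trans (sym (any≡true⁺ (memb (α l)) (lookup∈take es k k′ k<k′) in-k)) before-k′)
  ... | _ | _ | tri≈ _ k≡k′ _ = k≢k′ k≡k′
  ... | _ , before-k | in-k′ , _ | tri> _ _ k′<k =
    true≢false (trans (sym (any≡true⁺ (memb (α l)) (lookup∈take es k′ k k′<k) in-k′)) before-k)

  US-covers : ∀ es → Covers es → ∀ l → ∃[ k ] (Good es k × l Subset.∈ US es k)
  US-covers es covers l with covers l
  ... | k , l∈k with first-index (memb (α l)) es k l∈k
  ... | k′ , l∈k′ , before-k′ =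
    k′ , freshα⇒goodAfter l (take (toℕ k′) es) (lookup es k′) fresh ,
    lookup⇒[]= l (US es k′) (trans (lookup∘tabulate _ l) fresh)
    where
    fresh : memb (α l) (lookup es k′) ∧ not (any (memb (α l)) (take (toℕ k′) es)) ≡ true
    fresh rewrite l∈k′ | before-k′ = refl

  residualWeight : (es : List (Edge n m)) → Fin (length es) → ℕ
  residualWeight es k = freshWeight (take (toℕ k) es) (lookup es k)

  B*good : (es : List (Edge n m)) → Fin (length es) → ℕ
  B*good es k = B * bit (goodᵇ es k)

  module _ (es : List (Edge n m)) (es∈ : AllInFamily es) (covers : Covers es)
           (Σa≡mB : sum (map a (allFin n)) ≡ m * B) where

    sum-residualWeight : sum (map (residualWeight es) (allFin (length es))) ≡ m * B
    sum-residualWeight = trans (sum-allFin≡historySum freshWeight [] es)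
      (trans (sym (Covers⇒sum≡historySum-freshWeight es covers)) Σa≡mB)

    sum-B*good : sum (map (B*good es) (allFin (length es))) ≡ B * goodCount es
    sum-B*good = trans (sum-map-*ˡ B (bit ∘ goodᵇ es) (allFin (length es)))
      (cong (B *_) (sym (length-filterᵇ (goodᵇ es) (allFin (length es)))))

    residualWeight≤B*good : ∀ k → k ∈ allFin (length es) → residualWeight es k ≤ B*good es k
    residualWeight≤B*good k _ =
      freshWeight≤B*goodAfter (take (toℕ k) es) (lookup es k) (lookup-AllInFamily es∈ k)

    m≤goodCount : 0 < B → m ≤ goodCount es
    m≤goodCount B>0 = *-cancelʳ-≤ m (goodCount es) B {{>-nonZero B>0}} (begin
      m * B                                            ≡⟨ sum-residualWeight ⟨
      sum (map (residualWeight es) (allFin (length es)))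
        ≤⟨ sum-map-mono-≤ (residualWeight es) (B*good es) (allFin (length es)) residualWeight≤B*good ⟩
      sum (map (B*good es) (allFin (length es)))       ≡⟨ sum-B*good ⟩
      B * goodCount es                                 ≡⟨ *-comm B (goodCount es) ⟩
      goodCount es * B                                 ∎)
      where open ≤-Reasoning

    goodCount≡m⇒residualWeight≡B : goodCount es ≡ m → ∀ k → Good es k → residualWeight es k ≡ B
    goodCount≡m⇒residualWeight≡B count≡m k good = begin
      residualWeight es k    ≡⟨ sum-map-mono-≤-equality (residualWeight es) (B*good es) (allFin (length es))
                                  residualWeight≤B*good sum-B*good≤sum-residualWeight k (∈-allFin k) ⟩
      B * bit (goodᵇ es k)   ≡⟨ cong (λ b → B * bit b) good ⟩
      B * 1                  ≡⟨ *-identityʳ B ⟩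
      B                      ∎
      where
      open ≡-Reasoning
      sum-B*good≤sum-residualWeight :
        sum (map (B*good es) (allFin (length es))) ≤ sum (map (residualWeight es) (allFin (length es)))
      sum-B*good≤sum-residualWeight =
        ≤-reflexive (trans sum-B*good (trans (cong (B *_) count≡m) (trans (*-comm B m) (sym sum-residualWeight))))

lemma3 : (m : ℕ) (a : Fin (3 * m) → ℕ) (B : ℕ) →
    0 < B →
    sum (map a (allFin (3 * m))) ≡ m * B →
    (∀ l → B < 4 * a l) →
    (∀ l → 2 * a l < B) →
    let open Construction m a B in
    (es : List (Edge n m)) →
    AllInFamily es →
    Covers es →
    F es ≤ C →
    (length (filterᵇ (goodᵇ es) (allFin (length es))) ≡ m)
    × (∀ k k' → Good es k → Good es k' → k ≢ k' → ∀ l → l Subset.∈ US es k → l Subset.∉ US es k')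
    × (∀ k → Good es k → ∣ US es k ∣ ≡ 3)
    × (∀ l → ∃[ k ] (Good es k × l Subset.∈ US es k))
lemma3 m a B B>0 Σa≡mB B<4a _ es es∈ covers F≤C =
  count≡m , (λ k k′ _ _ → US-disjoint es k k′) , ∣US∣≡3 , US-covers es covers
  where
  open Construction m a B
  open Bounds m a B

  count≡m : goodCount es ≡ m
  count≡m = ≤-antisym (goodCount≤m es F≤C) (m≤goodCount es es∈ covers Σa≡mB B>0)

  a>0 : ∀ l → 0 < a l
  a>0 l = n≢0⇒n>0 λ a≡0 → <⇒≱ (B<4a l) (subst (λ x → 4 * x ≤ B) (sym a≡0) z≤n)

  ∣US∣≡3 : ∀ k → Good es k → ∣ US es k ∣ ≡ 3
  ∣US∣≡3 k good = freshWeight≡B⇒∣fresh∣≡3 (take (toℕ k) es) (lookup es k) a>0 (lookup-AllInFamily es∈ k) good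
    (goodCount≡m⇒residualWeight≡B es es∈ covers Σa≡mB count≡m k good)
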